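{- Let $G=(V,E)$ be an undirected graph, $M\subseteq E$ a matching, and $G_M=(V',E_M)$ the directed graph defined below. Then there exists an $M$-augmenting path in $G$ if and only if there exists a strongly simple path from $s$ to $t$ in $G_M$.
   Context: A matching $M\subseteq E$ is a set of edges no two of which share a node; a node is $M$-free if it is incident to no edge of $M$, and $V_M$ denotes the set of $M$-free nodes. An $M$-augmenting path is a simple path $v_0,\dots,v_k$ in $G$ whose edges alternate between $E\setminus M$ and $M$ and whose end nodes $v_0,v_k$ are both $M$-free. The directed graph $G_M=(V',E_M)$ is defined by $V'=\{[v,A],[v,B]\mid v\in V\}\cup\{s,t\}$ with $s,t$ two new distinct nodes, and $E_M=\{([v,A],[w,B]),([w,A],[v,B])\mid (v,w)\in M\}\cup\{([x,B],[y,A]),([y,B],[x,A])\mid (x,y)\in E\setminus M\}\cup\{(s,[v,B]),([v,A],t)\mid v\in V_M\}$. A path in $G_M$ is strongly simple if it is simple (no repeated node) and for no $v\in V$ does it contain both $[v,A]$ and $[v,B]$. -}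

module Defs where

open import Data.Nat using (ℕ; _≥_)
open import Data.Fin using (Fin)
open import Data.Bool using (Bool; true; false; not)
open import Data.List using (List; []; _∷_; _++_; [_]; length)
open import Data.List.Membership.Propositional using (_∈_)
open import Data.List.Relation.Unary.Unique.Propositional using (Unique)
open import Data.List.Relation.Unary.Linked using (Linked)
open import Data.Product using (Σ; _×_; ∃)
open import Data.Sum using (_⊎_)
open import Data.Unit using (⊤)
open import Data.Empty using (⊥)
open import Relation.Nullary using (¬_)
open import Relation.Binary.PropositionalEquality using (_≡_)

-- An undirected graph on the finite node set V = Fin n: the edge set is a
-- symmetric relation (an edge {x,y} is represented by both E x y and E y x).
record Graph (n : ℕ) : Set₁ where
  field
    E    : Fin n → Fin n → Set
    symE : ∀ {x y} → E x y → E y x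
open Graph public

record Matching {n : ℕ} (G : Graph n) : Set₁ where
  field
    M       : Fin n → Fin n → Set
    symM    : ∀ {x y} → M x y → M y x
    M⊆E     : ∀ {x y} → M x y → E G x y
    matched : ∀ {v w w'} → M v w → M v w' → w ≡ w'
open Matching public

module _ {n : ℕ} {G : Graph n} (Mt : Matching G) where

  Free : Fin n → Set
  Free v = ∀ w → ¬ M Mt v w

  NonM : Fin n → Fin n → Set
  NonM x y = E G x y × ¬ M Mt x y

  Alt : Bool → List (Fin n) → Set
  Alt b []            = ⊥
  Alt b (x ∷ [])      = ⊤
  Alt true  (x ∷ y ∷ p) = M Mt x y × Alt false (y ∷ p)
  Alt false (x ∷ y ∷ p) = NonM x y × Alt true (y ∷ p)

  record AugmentingPath : Set where
    field
      v₀ vₖ  : Fin n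
      inner  : List (Fin n)
      simple : Unique (v₀ ∷ inner ++ [ vₖ ])
      alt    : Alt true (v₀ ∷ inner ++ [ vₖ ]) ⊎ Alt false (v₀ ∷ inner ++ [ vₖ ])
      free₀  : Free v₀
      freeₖ  : Free vₖ

  data Side : Set where
    A B : Side

  data Node : Set where
    s t : Node
    ⟨_,_⟩ : Fin n → Side → Node

  data EM : Node → Node → Set where
    m₁ : ∀ {v w} → M Mt v w → EM ⟨ v , A ⟩ ⟨ w , B ⟩
    m₂ : ∀ {v w} → M Mt v w → EM ⟨ w , A ⟩ ⟨ v , B ⟩
    e₁ : ∀ {x y} → NonM x y → EM ⟨ x , B ⟩ ⟨ y , A ⟩
    e₂ : ∀ {x y} → NonM x y → EM ⟨ y , B ⟩ ⟨ x , A ⟩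
    src : ∀ {v} → Free v → EM s ⟨ v , B ⟩
    snk : ∀ {v} → Free v → EM ⟨ v , A ⟩ t

  record StronglySimpleSTPath : Set where
    field
      inner    : List Node
      edges    : Linked EM (s ∷ inner ++ [ t ])
      simple   : Unique (s ∷ inner ++ [ t ])
      strongly : ∀ v → ¬ (⟨ v , A ⟩ ∈ (s ∷ inner ++ [ t ]) × ⟨ v , B ⟩ ∈ (s ∷ inner ++ [ t ]))

-- A path v₀ … vₖ of G is translated into G_M by labelling its nodes with
-- alternating sides, starting with B:  s, [v₀,B], [v₁,A], [v₂,B], …, [vₖ,A], t.
-- Since v₀ is free, an augmenting path starts with a non-matching edge, so
-- its edges alternate non-M / M, which are exactly the edges B→A / A→B of
-- G_M; the free end nodes give the edges out of s and into t.
module Submission where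

open import Defs
open import Data.Nat using (ℕ)
open import Function.Bundles using (_⇔_; mk⇔)
open import Data.Fin using (Fin)
open import Data.Bool using (Bool; true; false)
open import Data.List using (List; []; _∷_; _++_; [_])
open import Data.List.Relation.Unary.Any using (here; there)
open import Data.List.Relation.Unary.All using ([]; _∷_)
open import Data.List.Relation.Unary.All.Properties using (¬Any⇒All¬; All¬⇒¬Any; ++⁻ˡ)
open import Data.List.Membership.Propositional using (_∈_; _∉_)
open import Data.List.Membership.Propositional.Properties using (∈-++⁻; ∈-++⁺ˡ)
open import Data.List.Relation.Unary.Unique.Propositional using (Unique)
open import Data.List.Relation.Unary.Unique.Propositional.Properties as Unique using ()
open import Data.List.Relation.Unary.AllPairs using ([]; _∷_)
open import Data.List.Relation.Unary.Linked using (Linked; [-]; _∷_)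
open import Data.Product using (∃; ∃₂; _×_; _,_)
open import Data.Sum using (_⊎_; inj₁; inj₂; fromInj₂)
open import Data.Unit using (tt)
open import Data.Empty using (⊥-elim)
open import Relation.Nullary using (¬_)
open import Relation.Binary.PropositionalEquality using (_≡_; refl; subst)

unique-++⁻ˡ : ∀ {a} {X : Set a} (xs : List X) {ys : List X} →
              Unique (xs ++ ys) → Unique xs
unique-++⁻ˡ []       _       = []
unique-++⁻ˡ (x ∷ xs) (a ∷ u) = ++⁻ˡ xs a ∷ unique-++⁻ˡ xs u

module _ {n : ℕ} {G : Graph n} (Mt : Matching G) where

  other : Side Mt → Side Mt
  other A = B
  other B = A

  label : Side Mt → List (Fin n) → List (Node Mt)
  label S []       = []
  label S (x ∷ xs) = ⟨ x , S ⟩ ∷ label (other S) xs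

  label-∈ : ∀ {v S'} S xs → ⟨ v , S' ⟩ ∈ label S xs → v ∈ xs
  label-∈ S (x ∷ xs) (here refl) = here refl
  label-∈ S (x ∷ xs) (there p)   = there (label-∈ (other S) xs p)

  ∈-label : ∀ {v} S xs → v ∈ xs → ∃ λ S' → ⟨ v , S' ⟩ ∈ label S xs
  ∈-label S (x ∷ xs) (here refl) = S , here refl
  ∈-label S (x ∷ xs) (there p) with ∈-label (other S) xs p
  ... | S' , q = S' , there q

  s∉label : ∀ S xs → s ∉ label S xs
  s∉label S (x ∷ xs) (there p) = s∉label (other S) xs p

  t∉label : ∀ S xs → t ∉ label S xs
  t∉label S (x ∷ xs) (there p) = t∉label (other S) xs p

  SidesAgree : List (Node Mt) → Set
  SidesAgree L = ∀ {v S₁ S₂} → ⟨ v , S₁ ⟩ ∈ L → ⟨ v , S₂ ⟩ ∈ L → S₁ ≡ S₂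

  NoTwins : List (Node Mt) → Set
  NoTwins L = ∀ v → ¬ (⟨ v , A ⟩ ∈ L × ⟨ v , B ⟩ ∈ L)

  agree⇒noTwins : ∀ {L} → SidesAgree L → NoTwins L
  agree⇒noTwins agree v (pA , pB) with agree pA pB
  ... | ()

  noTwins⇒agree : ∀ {L} → NoTwins L → SidesAgree L
  noTwins⇒agree noTwins {S₁ = A} {S₂ = A} p q = refl
  noTwins⇒agree noTwins {S₁ = B} {S₂ = B} p q = refl
  noTwins⇒agree noTwins {S₁ = A} {S₂ = B} p q = ⊥-elim (noTwins _ (p , q))
  noTwins⇒agree noTwins {S₁ = B} {S₂ = A} p q = ⊥-elim (noTwins _ (q , p))

  label-unique : ∀ S xs → Unique xs → Unique (label S xs)
  label-unique S []       _       = []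
  label-unique S (x ∷ xs) (a ∷ u) =
    ¬Any⇒All¬ _ (λ p → All¬⇒¬Any a (label-∈ (other S) xs p))
      ∷ label-unique (other S) xs u

  label-agree : ∀ S xs → Unique xs → SidesAgree (label S xs)
  label-agree S (x ∷ xs) (a ∷ u) (here refl) (here refl) = refl
  label-agree S (x ∷ xs) (a ∷ u) (here refl) (there q)   =
    ⊥-elim (All¬⇒¬Any a (label-∈ _ xs q))
  label-agree S (x ∷ xs) (a ∷ u) (there p)   (here refl) =
    ⊥-elim (All¬⇒¬Any a (label-∈ _ xs p))
  label-agree S (x ∷ xs) (a ∷ u) (there p)   (there q)   =
    label-agree (other S) xs u p q

  label-unique⁻ : ∀ S xs → Unique (label S xs) → SidesAgree (label S xs) → Unique xs
  label-unique⁻ S []       _       _     = []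
  label-unique⁻ S (x ∷ xs) (a ∷ u) agree =
    ¬Any⇒All¬ xs x∉xs ∷ label-unique⁻ (other S) xs u (λ p q → agree (there p) (there q))
    where
      -- a second occurrence of x has, by agreement, the same side as the first
      x∉xs : x ∉ xs
      x∉xs p with ∈-label (other S) xs p
      ... | S' , q = All¬⇒¬Any a (subst (λ S'' → ⟨ x , S'' ⟩ ∈ _) (agree (there q) (here refl)) q)

  framed : List (Node Mt) → List (Node Mt)
  framed L = s ∷ L ++ [ t ]

  unframe-∈ : ∀ {v S} L → ⟨ v , S ⟩ ∈ framed L → ⟨ v , S ⟩ ∈ L
  unframe-∈ L (there p) with ∈-++⁻ L p
  ... | inj₁ q = q
  ... | inj₂ (here ())

  frame-agree : ∀ {L} → SidesAgree L → SidesAgree (framed L)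
  frame-agree {L} agree p q = agree (unframe-∈ L p) (unframe-∈ L q)

  unframe-agree : ∀ {L} → SidesAgree (framed L) → SidesAgree L
  unframe-agree {L} agree p q = agree (there (∈-++⁺ˡ p)) (there (∈-++⁺ˡ q))

  frame-unique : ∀ L → s ∉ L → t ∉ L → Unique L → Unique (framed L)
  frame-unique L s∉L t∉L u =
    ¬Any⇒All¬ _ s∉L++t ∷ Unique.++⁺ u ([] ∷ []) (λ { (p , here refl) → t∉L p })
    where
      s∉L++t : s ∉ L ++ [ t ]
      s∉L++t p with ∈-++⁻ L p
      ... | inj₁ q = s∉L q
      ... | inj₂ (here ())

  unframe-unique : ∀ L → Unique (framed L) → Unique L
  unframe-unique L (_ ∷ u) = unique-++⁻ˡ L u

  -- The shape  x ∷ p ++ [ z ]  keeps the end node visible.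
  mutual
    linkFromA : ∀ x p z → Alt Mt true (x ∷ p ++ [ z ]) → Free Mt z →
                Linked (EM Mt) (label A (x ∷ p ++ [ z ]) ++ [ t ])
    linkFromA x []      z (m , _)   z-free = ⊥-elim (z-free x (symM Mt m))
    linkFromA x (y ∷ p) z (m , alt) z-free = m₁ m ∷ linkFromB y p z alt z-free

    linkFromB : ∀ x p z → Alt Mt false (x ∷ p ++ [ z ]) → Free Mt z →
                Linked (EM Mt) (label B (x ∷ p ++ [ z ]) ++ [ t ])
    linkFromB x []      z (e , _)   z-free = e₁ e ∷ snk z-free ∷ [-]
    linkFromB x (y ∷ p) z (e , alt) z-free = e₁ e ∷ linkFromA y p z alt z-free

  free-start-nonM : ∀ {x} p {z} → Free Mt x → ¬ Alt Mt true (x ∷ p ++ [ z ])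
  free-start-nonM []      x-free (m , _) = x-free _ m
  free-start-nonM (y ∷ p) x-free (m , _) = x-free y m

  toSTPath : AugmentingPath Mt → StronglySimpleSTPath Mt
  toSTPath P = record
    { inner    = label B path
    ; edges    = src free₀ ∷ linkFromB v₀ inner vₖ alt' freeₖ
    ; simple   = frame-unique (label B path) (s∉label B path) (t∉label B path)
                   (label-unique B path simple)
    ; strongly = agree⇒noTwins (frame-agree (label-agree B path simple))
    }
    where
      open AugmentingPath P
      path = v₀ ∷ inner ++ [ vₖ ]
      alt' : Alt Mt false path
      alt' = fromInj₂ (λ a → ⊥-elim (free-start-nonM inner free₀ a)) alt

  symNonM : ∀ {x y} → NonM Mt x y → NonM Mt y x
  symNonM (e , e∉M) = symE G e , λ m → e∉M (symM Mt m)

  AltTail : Bool → Side Mt → Fin n → List (Node Mt) → Set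
  AltTail b S x rest = ∃₂ λ p z →
    (rest ≡ label S (p ++ [ z ])) × Alt Mt b (x ∷ p ++ [ z ]) × Free Mt z

  extendNonM : ∀ {x y rest} → NonM Mt x y → (rest ≡ [] × Free Mt y) ⊎ AltTail true B y rest →
               AltTail false A x (⟨ y , A ⟩ ∷ rest)
  extendNonM e (inj₁ (refl , y-free))          = [] , _ , refl , (e , tt) , y-free
  extendNonM e (inj₂ (p , z , refl , alt , f)) = _ ∷ p , z , refl , (e , alt) , f

  extendM : ∀ {y w rest} → M Mt y w → AltTail false A w rest → AltTail true B y (⟨ w , B ⟩ ∷ rest)
  extendM m (p , z , refl , alt , f) = _ ∷ p , z , refl , (m , alt) , f

  -- t has no outgoing edges, so a walk cannot pass through t.
  t-is-sink : ∀ rest → ¬ Linked (EM Mt) (t ∷ rest ++ [ t ])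
  t-is-sink []      (() ∷ _)
  t-is-sink (_ ∷ _) (() ∷ _)

  mutual
    decodeB : ∀ x rest → Linked (EM Mt) (⟨ x , B ⟩ ∷ rest ++ [ t ]) → AltTail false A x rest
    decodeB x []                 (() ∷ _)
    decodeB x (⟨ y , A ⟩ ∷ rest) (e₁ e ∷ l) = extendNonM e (decodeA y rest l)
    decodeB x (⟨ y , A ⟩ ∷ rest) (e₂ e ∷ l) = extendNonM (symNonM e) (decodeA y rest l)

    decodeA : ∀ y rest → Linked (EM Mt) (⟨ y , A ⟩ ∷ rest ++ [ t ]) →
              (rest ≡ [] × Free Mt y) ⊎ AltTail true B y rest
    decodeA y []                 (snk y-free ∷ _) = inj₁ (refl , y-free)
    decodeA y (_ ∷ rest)         (snk _ ∷ l) = ⊥-elim (t-is-sink rest l)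
    decodeA y (⟨ w , B ⟩ ∷ rest) (m₁ m ∷ l) = inj₂ (extendM m (decodeB w rest l))
    decodeA y (⟨ w , B ⟩ ∷ rest) (m₂ m ∷ l) = inj₂ (extendM (symM Mt m) (decodeB w rest l))

  fromSTPath : StronglySimpleSTPath Mt → AugmentingPath Mt
  fromSTPath record { inner = [] ; edges = () ∷ _ }
  fromSTPath record { inner = ⟨ x , B ⟩ ∷ rest ; edges = src x-free ∷ l
                    ; simple = simple ; strongly = strongly }
    with decodeB x rest l
  ... | p , z , refl , alt , z-free = record
    { v₀ = x ; vₖ = z ; inner = p
    ; simple = label-unique⁻ B path (unframe-unique (label B path) simple)
                 (unframe-agree (noTwins⇒agree strongly))
    ; alt = inj₂ alt ; free₀ = x-free ; freeₖ = z-free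
    }
    where path = x ∷ p ++ [ z ]

theorem2 : ∀ {n : ℕ} (G : Graph n) (Mt : Matching G) →
    AugmentingPath Mt ⇔ StronglySimpleSTPath Mt
theorem2 G Mt = mk⇔ (toSTPath Mt) (fromSTPath Mt)
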